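{- Let $V$ be a finite set with $|V|$ even, let $G=(V,E)$ be an $r$-regular graph, and let $d\mapsto (H(d),A(d))$, $d\in\{1,\ldots,r\}$, be any HAP table. Then the polytope $P(G,HA)$ contains an integral point if and only if there exists $v\in \mathbf N(PM(V))$ such that $v|_K=\chi_E$ and $v(c)=|\{d\in\{1,\ldots,r\} : c=\{H(d),A(d)\}\}|$ for every $c\in C$.
   Context: Let $K=\binom{V}{2}$ and let $C$ be the set of partitions $\{A,B\}$ of $V$ with $|A|=|B|=|V|/2$. For $c=\{A,B\}\in C$, $B_c$ is the complete bipartite graph with parts $A,B$. In $\mathbb N^{K\cup C}$ ($\mathbb N$ = nonnegative integers), $v|_K$ denotes restriction to the $K$-coordinates, and $\chi_E$ is the $0/1$ indicator vector on $K$ of the edge set $E$. For a perfect matching $q$ of $B_c$, $\chi_{q,c}$ is the vector with value $1$ on the edges of $q$ and on coordinate $c$, $0$ elsewhere; $PM(V)$ is the set of all such $\chi_{q,c}$, and $\mathbf N(PM(V))$ is the set of nonnegative integer combinations of elements of $PM(V)$. A HAP table for $r$ days is a map assigning to each $d\in\{1,\dots,r\}$ a pair $(H(d),A(d))$ of disjoint subsets of $V$ with $|H(d)|=|A(d)|=|V|/2$. $P(G,HA)$ is the set of real vectors $x=(x_{\{a,b\},d})_{\{a,b\}\in K,\ d\in\{1,\dots,r\}}$ satisfying: (1) $\sum_{d=1}^r x_{\{a,b\},d}=1$ for every $\{a,b\}\in E$, and $x_{\{a,b\},d}=0$ for $\{a,b\}\notin E$; (2) $\sum_{b\in V, b\ne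 a} x_{\{a,b\},d}=1$ for every $d$ and every $a\in V$; (3) $0\le x_{\{a,b\},d}\le 1$ for every $d$ and $\{a,b\}\in E$; (4) for every $d$ and $\{a,b\}\in E$, if $a,b\in H(d)$ or $a,b\in A(d)$ then $x_{\{a,b\},d}=0$. -}

module Defs where

open import Data.Nat as ℕ using (ℕ; zero; suc; _/_)
open import Data.Integer as ℤ using (ℤ)
open import Data.Bool using (Bool; true; false; if_then_else_; _∧_; _∨_)
open import Data.Fin using (Fin; zero; suc; _<_)
open import Data.Fin.Properties using (<-cmp)
open import Data.Fin.Subset using (Subset; _∈_; ∣_∣)
open import Data.Fin.Subset.Properties using (_∈?_)
open import Data.Vec.Properties using (≡-dec)
open import Data.Bool.Properties using () renaming (_≟_ to _≟ᵇ_)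
open import Data.Product using (Σ; Σ-syntax; _×_; _,_; proj₁; proj₂)
open import Data.Sum using (_⊎_)
open import Data.List using (List; []; _∷_)
open import Data.Empty using (⊥)
open import Relation.Binary using (tri<; tri≈; tri>)
open import Relation.Binary.PropositionalEquality using (_≡_)
open import Relation.Nullary.Decidable using (isYes)

-- Vertex set V = Fin n.
-- K n : unordered pairs {a,b} of distinct vertices, encoded canonically as a < b.
K : ℕ → Set
K n = Σ[ a ∈ Fin n ] Σ[ b ∈ Fin n ] a < b

lo hi : ∀ {n} → K n → Fin n
lo k = proj₁ k
hi k = proj₁ (proj₂ k)

-- value of a K-indexed function at the pair {a,b}; default value for a = b
at : ∀ {n} {A : Set} → (K n → A) → Fin n → Fin n → A → A
at f a b dflt with <-cmp a b
... | tri< lt _ _ = f (a , b , lt)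
... | tri≈ _ _ _ = dflt
... | tri> _ _ gt = f (b , a , gt)

sumℕ : ∀ {m} → (Fin m → ℕ) → ℕ
sumℕ {zero} f = 0
sumℕ {suc m} f = f zero ℕ.+ sumℕ (λ i → f (suc i))

sumℤ : ∀ {m} → (Fin m → ℤ) → ℤ
sumℤ {zero} f = ℤ.0ℤ
sumℤ {suc m} f = f zero ℤ.+ sumℤ (λ i → f (suc i))

ind : Bool → ℕ
ind true = 1
ind false = 0

Graph : ℕ → Set
Graph n = K n → Bool

degree : ∀ {n} → Graph n → Fin n → ℕ
degree E a = sumℕ (λ b → at (λ k → ind (E k)) a b 0)

Regular : ∀ {n} → ℕ → Graph n → Set
Regular r E = ∀ a → degree E a ≡ r

Disjoint : ∀ {n} → Subset n → Subset n → Set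
Disjoint S T = ∀ i → i ∈ S → i ∈ T → ⊥

record HAPTable (n r : ℕ) : Set where
  field
    H A : Fin r → Subset n
    disj : ∀ d → Disjoint (H d) (A d)
    sizeH : ∀ d → ∣ H d ∣ ≡ n / 2
    sizeA : ∀ d → ∣ A d ∣ ≡ n / 2
open HAPTable public

-- an element of C: a partition {A,B} of V with |A| = |B| = |V|/2.
-- Stored as an ordered pair; {A,B} and {B,A} are identified via sameC below.
record Cut (n : ℕ) : Set where
  constructor cut
  field
    side₁ side₂ : Subset n
    disjoint : Disjoint side₁ side₂
    cover : ∀ i → i ∈ side₁ ⊎ i ∈ side₂
    size₁ : ∣ side₁ ∣ ≡ n / 2
    size₂ : ∣ side₂ ∣ ≡ n / 2
open Cut public

eqSub : ∀ {n} → Subset n → Subset n → Bool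
eqSub S T = isYes (≡-dec _≟ᵇ_ S T)

samePair : ∀ {n} → Subset n → Subset n → Subset n → Subset n → Bool
samePair S T S' T' = (eqSub S S' ∧ eqSub T T') ∨ (eqSub S T' ∧ eqSub T S')

sameC : ∀ {n} → Cut n → Cut n → Bool
sameC c c' = samePair (side₁ c) (side₂ c) (side₁ c') (side₂ c')

bothIn : ∀ {n} → Fin n → Fin n → Subset n → Set
bothIn a b S = a ∈ S × b ∈ S

-- {a,b} is an edge of the complete bipartite graph B_c
Crossing : ∀ {n} → Cut n → K n → Set
Crossing c k = (lo k ∈ side₁ c × hi k ∈ side₂ c) ⊎ (lo k ∈ side₂ c × hi k ∈ side₁ c)

PerfectMatching : ∀ {n} → Cut n → (K n → Bool) → Set
PerfectMatching {n} c q =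
  (∀ k → q k ≡ true → Crossing c k) ×
  (∀ a → sumℕ (λ b → at (λ k → ind (q k)) a b 0) ≡ 1)

record PMElem (n : ℕ) : Set where
  constructor pm
  field
    part : Cut n
    matching : K n → Bool
    isPM : PerfectMatching part matching
open PMElem public

-- An element v of N(PM(V)) is a nonnegative integer combination of elements
-- of PM(V); we represent the combination as a finite list (with repetitions).
-- Its K-coordinates and C-coordinates:
vK : ∀ {n} → List (PMElem n) → K n → ℕ
vK [] k = 0
vK (p ∷ ps) k = ind (matching p k) ℕ.+ vK ps k

vC : ∀ {n} → List (PMElem n) → Cut n → ℕ
vC [] c = 0
vC (p ∷ ps) c = ind (sameC (part p) c) ℕ.+ vC ps c

daysOf : ∀ {n r} → HAPTable n r → Cut n → ℕ
daysOf HA c = sumℕ (λ d → ind (samePair (H HA d) (A HA d) (side₁ c) (side₂ c)))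

InP : ∀ {n r} → Graph n → HAPTable n r → (K n → Fin r → ℤ) → Set
InP {n} {r} E HA x =
  -- (1)
  (∀ k → E k ≡ true → sumℤ (λ d → x k d) ≡ ℤ.1ℤ) ×
  (∀ k → E k ≡ false → ∀ d → x k d ≡ ℤ.0ℤ) ×
  -- (2)
  (∀ d a → sumℤ (λ b → at (λ k → x k d) a b ℤ.0ℤ) ≡ ℤ.1ℤ) ×
  -- (3)
  (∀ d k → E k ≡ true → (ℤ.0ℤ ℤ.≤ x k d) × (x k d ℤ.≤ ℤ.1ℤ)) ×
  -- (4)
  (∀ d k → E k ≡ true →
     (bothIn (lo k) (hi k) (H HA d) ⊎ bothIn (lo k) (hi k) (A HA d)) →
     x k d ≡ ℤ.0ℤ)

module Submission where

-- Write c_d = {H(d),A(d)} for the cut played on day d (a genuine element of C,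
-- because two disjoint halves of V cover V).  An integral point x of P(G,HA) is
-- a 0/1 vector by (3) and (1), so it is the same thing as a family of edge sets
-- M_d = {k : x_{k,d} = 1}; constraints (1)-(4) then say precisely that each M_d
-- is a perfect matching of B_{c_d} and that every edge of E lies in exactly one
-- M_d, while non-edges lie in none.  Such a family gives v = Σ_d χ_{M_d,c_d}.
-- Conversely, a combination v ∈ N(PM(V)) whose C-coordinates count the days of
-- each cut can be re-indexed by the days, one summand per day, with summand d
-- living on a cut equal to c_d; its matchings are then such a family.

open import Defs
open import Data.Nat using (ℕ)
open import Data.Nat.Divisibility using (_∣_)
open import Data.Integer using (ℤ)
open import Data.Fin using (Fin)
open import Data.List using (List)
open import Data.Product using (Σ-syntax; _×_)
open import Function.Bundles using (_⇔_)
open import Relation.Binary.PropositionalEquality using (_≡_)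

open import Data.Bool using (Bool; true; false; _∧_; _∨_)
open import Data.Bool.Properties using (∧-conicalˡ; ∧-conicalʳ; ∧-comm; ∨-comm)
  renaming (_≟_ to _≟ᵇ_)
open import Data.Empty using (⊥; ⊥-elim)
open import Data.Fin using (zero; suc)
open import Data.Fin.Properties using (<-cmp)
open import Data.Fin.Subset using (Subset; _∈_; ∣_∣; inside; outside)
open import Data.Integer as ℤ using (+_; -[1+_]; +≤+)
open import Data.Integer.Properties using (+-injective)
open import Data.List using ([]; _∷_)
open import Data.Nat using (zero; suc; _+_; _≤_; z≤n; s≤s; _/_)
open import Data.Nat.DivMod using (m*[n/m]≡n)
open import Data.Nat.Properties
  using (+-identityʳ; +-suc; +-cancelˡ-≡; m+n≡0⇒m≡0; m+n≡0⇒n≡0; suc-injective;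
         m≤n⇒m≤1+n; n≮n; +-commutativeSemigroup)
open import Algebra.Properties.CommutativeSemigroup +-commutativeSemigroup using (x∙yz≈y∙xz)
open import Data.Product using (_,_; proj₁; proj₂)
open import Data.Sum using (_⊎_; inj₁; inj₂; swap; map)
open import Data.Vec using ([]; _∷_; _[_]=_)
open _[_]=_ using (here; there)
open import Data.Vec.Properties using (≡-dec)
open import Function using (_∘_)
open import Function.Bundles using (mk⇔)
open import Relation.Binary using (tri<; tri≈; tri>)
open import Relation.Binary.PropositionalEquality
  using (refl; sym; trans; cong; cong₂; subst; module ≡-Reasoning)
open import Relation.Nullary using (yes; no)
open import Relation.Nullary.Decidable using (isYes)

disjoint-tail : ∀ {m x y} {S T : Subset m} → Disjoint (x ∷ S) (y ∷ T) → Disjoint S T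
disjoint-tail disj i i∈S i∈T = disj (suc i) (there i∈S) (there i∈T)

disjoint-size : ∀ {m} (S T : Subset m) → Disjoint S T → ∣ S ∣ + ∣ T ∣ ≤ m
disjoint-size [] [] _ = z≤n
disjoint-size (inside ∷ S) (inside ∷ T) disj = ⊥-elim (disj zero here here)
disjoint-size (inside ∷ S) (outside ∷ T) disj = s≤s (disjoint-size S T (disjoint-tail disj))
disjoint-size (outside ∷ S) (inside ∷ T) disj rewrite +-suc ∣ S ∣ ∣ T ∣ =
  s≤s (disjoint-size S T (disjoint-tail disj))
disjoint-size (outside ∷ S) (outside ∷ T) disj =
  m≤n⇒m≤1+n (disjoint-size S T (disjoint-tail disj))

disjoint-full-cover : ∀ {m} (S T : Subset m) → Disjoint S T → ∣ S ∣ + ∣ T ∣ ≡ m →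
  ∀ i → i ∈ S ⊎ i ∈ T
disjoint-full-cover (inside ∷ S) (inside ∷ T) disj _ _ = ⊥-elim (disj zero here here)
disjoint-full-cover (inside ∷ S) (outside ∷ T) _ _ zero = inj₁ here
disjoint-full-cover (outside ∷ S) (inside ∷ T) _ _ zero = inj₂ here
disjoint-full-cover (inside ∷ S) (outside ∷ T) disj size (suc i) =
  map there there
    (disjoint-full-cover S T (disjoint-tail disj) (suc-injective size) i)
disjoint-full-cover (outside ∷ S) (inside ∷ T) disj size (suc i) =
  map there there
    (disjoint-full-cover S T (disjoint-tail disj)
      (suc-injective (trans (sym (+-suc ∣ S ∣ ∣ T ∣)) size)) i)
disjoint-full-cover {suc m} (outside ∷ S) (outside ∷ T) disj size _ =
  ⊥-elim (n≮n m (subst (_≤ m) size (disjoint-size S T (disjoint-tail disj))))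

halves : ∀ n → 2 ∣ n → n / 2 + n / 2 ≡ n
halves n 2∣n = trans (cong (_+_ (n / 2)) (sym (+-identityʳ (n / 2)))) (m*[n/m]≡n 2∣n)

module _ {n r : ℕ} (2∣n : 2 ∣ n) (HA : HAPTable n r) where

  dayCut : Fin r → Cut n
  dayCut d = cut (H HA d) (A HA d) (disj HA d) covers (sizeH HA d) (sizeA HA d)
    where
    covers : ∀ i → i ∈ H HA d ⊎ i ∈ A HA d
    covers = disjoint-full-cover (H HA d) (A HA d) (disj HA d)
      (trans (cong₂ _+_ (sizeH HA d) (sizeA HA d)) (halves n 2∣n))

Crosses : ∀ {n} → Fin n → Fin n → Subset n → Subset n → Set
Crosses a b S T = (a ∈ S × b ∈ T) ⊎ (a ∈ T × b ∈ S)

crossing-not-inside : ∀ {n} {S T : Subset n} {a b : Fin n} → Disjoint S T →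
  Crosses a b S T → bothIn a b S ⊎ bothIn a b T → ⊥
crossing-not-inside {b = b} disj (inj₁ (_ , b∈T)) (inj₁ (_ , b∈S)) = disj b b∈S b∈T
crossing-not-inside {a = a} disj (inj₁ (a∈S , _)) (inj₂ (a∈T , _)) = disj a a∈S a∈T
crossing-not-inside {a = a} disj (inj₂ (a∈T , _)) (inj₁ (a∈S , _)) = disj a a∈S a∈T
crossing-not-inside {b = b} disj (inj₂ (_ , b∈S)) (inj₂ (_ , b∈T)) = disj b b∈S b∈T

cover-not-inside-crossing : ∀ {n} {S T : Subset n} {a b : Fin n} →
  (∀ i → i ∈ S ⊎ i ∈ T) → (bothIn a b S ⊎ bothIn a b T → ⊥) → Crosses a b S T
cover-not-inside-crossing {a = a} {b} covers notInside with covers a | covers b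
... | inj₁ a∈S | inj₂ b∈T = inj₁ (a∈S , b∈T)
... | inj₂ a∈T | inj₁ b∈S = inj₂ (a∈T , b∈S)
... | inj₁ a∈S | inj₁ b∈S = ⊥-elim (notInside (inj₁ (a∈S , b∈S)))
... | inj₂ a∈T | inj₂ b∈T = ⊥-elim (notInside (inj₂ (a∈T , b∈T)))

eqSub-sound : ∀ {n} {S T : Subset n} → eqSub S T ≡ true → S ≡ T
eqSub-sound {S = S} {T} same with ≡-dec _≟ᵇ_ S T
... | yes S≡T = S≡T

eqSub-refl : ∀ {n} (S : Subset n) → eqSub S S ≡ true
eqSub-refl S with ≡-dec _≟ᵇ_ S S
... | yes _ = refl
... | no S≢S = ⊥-elim (S≢S refl)

∨-true : ∀ x y → x ∨ y ≡ true → x ≡ true ⊎ y ≡ true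
∨-true true _ _ = inj₁ refl
∨-true false _ y≡true = inj₂ y≡true

samePair-sound : ∀ {n} {S T S' T' : Subset n} → samePair S T S' T' ≡ true →
  (S ≡ S' × T ≡ T') ⊎ (S ≡ T' × T ≡ S')
samePair-sound {S = S} {T} {S'} {T'} same =
  map bothEqual bothEqual (∨-true (eqSub S S' ∧ eqSub T T') _ same)
  where
  bothEqual : ∀ {X Y X' Y' : Subset _} → eqSub X X' ∧ eqSub Y Y' ≡ true → X ≡ X' × Y ≡ Y'
  bothEqual eqs = eqSub-sound (∧-conicalˡ _ _ eqs) , eqSub-sound (∧-conicalʳ _ _ eqs)

samePair-refl : ∀ {n} (S T : Subset n) → samePair S T S T ≡ true
samePair-refl S T rewrite eqSub-refl S | eqSub-refl T = refl

samePair-swap : ∀ {n} (S T X Y : Subset n) → samePair T S X Y ≡ samePair S T X Y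
samePair-swap S T X Y rewrite ∧-comm (eqSub T X) (eqSub S Y) | ∧-comm (eqSub T Y) (eqSub S X) =
  ∨-comm (eqSub S Y ∧ eqSub T X) (eqSub S X ∧ eqSub T Y)

samePair-trans : ∀ {n} (S T S' T' X Y : Subset n) →
  samePair S T S' T' ≡ true → samePair S T X Y ≡ samePair S' T' X Y
samePair-trans S T S' T' X Y same with samePair-sound {S = S} {T} {S'} {T'} same
... | inj₁ (refl , refl) = refl
... | inj₂ (refl , refl) = samePair-swap S' T' X Y

sameC-refl : ∀ {n} (c : Cut n) → sameC c c ≡ true
sameC-refl c = samePair-refl (side₁ c) (side₂ c)

sameC-trans : ∀ {n} {c c' : Cut n} (x : Cut n) → sameC c c' ≡ true → sameC c x ≡ sameC c' x
sameC-trans {c = c} {c'} x =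
  samePair-trans (side₁ c) (side₂ c) (side₁ c') (side₂ c') (side₁ x) (side₂ x)

crosses-resp : ∀ {n} {S T S' T' : Subset n} {a b : Fin n} →
  (S ≡ S' × T ≡ T') ⊎ (S ≡ T' × T ≡ S') → Crosses a b S T → Crosses a b S' T'
crosses-resp (inj₁ (refl , refl)) crosses = crosses
crosses-resp (inj₂ (refl , refl)) crosses = swap crosses

perfectMatching-resp : ∀ {n} {c c' : Cut n} {q : K n → Bool} → sameC c c' ≡ true →
  PerfectMatching c q → PerfectMatching c' q
perfectMatching-resp {c = c} {c'} same (crossesCut , degreeOne) =
  (λ k inQ → crosses-resp (samePair-sound {S = side₁ c} {side₂ c} {side₁ c'} {side₂ c'} same)
                          (crossesCut k inQ)) , degreeOne

sumℤ-cong : ∀ {m} {f g : Fin m → ℤ} → (∀ i → f i ≡ g i) → sumℤ f ≡ sumℤ g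
sumℤ-cong {zero} _ = refl
sumℤ-cong {suc m} f≗g = cong₂ ℤ._+_ (f≗g zero) (sumℤ-cong (f≗g ∘ suc))

sumℤ-pos : ∀ {m} (f : Fin m → ℕ) → sumℤ (λ i → + f i) ≡ + sumℕ f
sumℤ-pos {zero} _ = refl
sumℤ-pos {suc m} f = cong (λ s → + f zero ℤ.+ s) (sumℤ-pos (f ∘ suc))

sumℕ-zeros : ∀ {m} (f : Fin m → ℕ) → (∀ i → f i ≡ 0) → sumℕ f ≡ 0
sumℕ-zeros {zero} _ _ = refl
sumℕ-zeros {suc m} f f≗0 = cong₂ _+_ (f≗0 zero) (sumℕ-zeros (f ∘ suc) (f≗0 ∘ suc))

sumℕ≡0⇒zeros : ∀ {m} (f : Fin m → ℕ) → sumℕ f ≡ 0 → ∀ i → f i ≡ 0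
sumℕ≡0⇒zeros f sum≡0 zero = m+n≡0⇒m≡0 (f zero) sum≡0
sumℕ≡0⇒zeros f sum≡0 (suc i) = sumℕ≡0⇒zeros (f ∘ suc) (m+n≡0⇒n≡0 (f zero) sum≡0) i

at-map : ∀ {n} {X Y : Set} (g : X → Y) (f : K n → X) a b dflt →
  at (g ∘ f) a b (g dflt) ≡ g (at f a b dflt)
at-map g f a b dflt with <-cmp a b
... | tri< _ _ _ = refl
... | tri≈ _ _ _ = refl
... | tri> _ _ _ = refl

at-cong : ∀ {n} {X : Set} {f g : K n → X} → (∀ k → f k ≡ g k) → ∀ a b dflt →
  at f a b dflt ≡ at g a b dflt
at-cong f≗g a b dflt with <-cmp a b
... | tri< _ _ _ = f≗g _
... | tri≈ _ _ _ = refl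
... | tri> _ _ _ = f≗g _

unit-interval : (z : ℤ) → ℤ.0ℤ ℤ.≤ z → z ℤ.≤ ℤ.1ℤ → z ≡ + ind (isYes (z ℤ.≟ ℤ.1ℤ))
unit-interval (+ 0) _ _ = refl
unit-interval (+ 1) _ _ = refl
unit-interval (+ suc (suc _)) _ (+≤+ (s≤s ()))
unit-interval -[1+ _ ] () _

ind≤1 : ∀ b → ind b ≤ 1
ind≤1 true = s≤s z≤n
ind≤1 false = z≤n

Decomposes : ∀ {n r} → Graph n → (Fin r → K n → Bool) → Set
Decomposes E M = ∀ k → sumℕ (λ d → ind (M d k)) ≡ ind (E k)

DayMatchings : ∀ {n r} → 2 ∣ n → Graph n → HAPTable n r → (Fin r → K n → Bool) → Set
DayMatchings 2∣n E HA M = (∀ d → PerfectMatching (dayCut 2∣n HA d) (M d)) × Decomposes E M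

module PointToMatchings {n r : ℕ} (2∣n : 2 ∣ n) (E : Graph n) (HA : HAPTable n r)
  (x : K n → Fin r → ℤ) (x∈P : InP E HA x) where

  sum-edges : ∀ k → E k ≡ true → sumℤ (λ d → x k d) ≡ ℤ.1ℤ
  sum-edges = proj₁ x∈P

  zero-off-edges : ∀ k → E k ≡ false → ∀ d → x k d ≡ ℤ.0ℤ
  zero-off-edges = proj₁ (proj₂ x∈P)

  degree-one : ∀ d a → sumℤ (λ b → at (λ k → x k d) a b ℤ.0ℤ) ≡ ℤ.1ℤ
  degree-one = proj₁ (proj₂ (proj₂ x∈P))

  bounds : ∀ d k → E k ≡ true → (ℤ.0ℤ ℤ.≤ x k d) × (x k d ℤ.≤ ℤ.1ℤ)
  bounds = proj₁ (proj₂ (proj₂ (proj₂ x∈P)))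

  zero-inside : ∀ d k → E k ≡ true →
    bothIn (lo k) (hi k) (H HA d) ⊎ bothIn (lo k) (hi k) (A HA d) → x k d ≡ ℤ.0ℤ
  zero-inside = proj₂ (proj₂ (proj₂ (proj₂ x∈P)))

  M : Fin r → K n → Bool
  M d k = isYes (x k d ℤ.≟ ℤ.1ℤ)

  x-is-indicator : ∀ k d → x k d ≡ + ind (M d k)
  x-is-indicator k d with E k in isEdge
  ... | true = unit-interval (x k d) (proj₁ (bounds d k isEdge)) (proj₂ (bounds d k isEdge))
  ... | false rewrite zero-off-edges k isEdge d = refl

  M-nonzero : ∀ d k → M d k ≡ true → x k d ≡ ℤ.0ℤ → ⊥
  M-nonzero d k inM x≡0
    with trans (sym x≡0) (trans (x-is-indicator k d) (cong (+_ ∘ ind) inM))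
  ... | ()

  M-edge : ∀ d k → M d k ≡ true → E k ≡ true
  M-edge d k inM with E k in isEdge
  ... | true = refl
  ... | false = ⊥-elim (M-nonzero d k inM (zero-off-edges k isEdge d))

  M-crossing : ∀ d k → M d k ≡ true → Crossing (dayCut 2∣n HA d) k
  M-crossing d k inM = cover-not-inside-crossing (cover (dayCut 2∣n HA d)) notInside
    where
    notInside : bothIn (lo k) (hi k) (H HA d) ⊎ bothIn (lo k) (hi k) (A HA d) → ⊥
    notInside withinSide = M-nonzero d k inM (zero-inside d k (M-edge d k inM) withinSide)

  M-degree : ∀ d a → sumℕ (λ b → at (λ k → ind (M d k)) a b 0) ≡ 1
  M-degree d a = +-injective (begin
    + sumℕ row                                     ≡⟨ sym (sumℤ-pos row) ⟩
    sumℤ (λ b → + row b)                           ≡⟨ sumℤ-cong (λ b → sym (at-map +_ _ a b 0)) ⟩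
    sumℤ (λ b → at (λ k → + ind (M d k)) a b ℤ.0ℤ) ≡⟨ sumℤ-cong (λ b → at-cong x≗M a b ℤ.0ℤ) ⟩
    sumℤ (λ b → at (λ k → x k d) a b ℤ.0ℤ)         ≡⟨ degree-one d a ⟩
    ℤ.1ℤ                                           ∎)
    where
    open ≡-Reasoning
    row : Fin n → ℕ
    row b = at (λ k → ind (M d k)) a b 0
    x≗M : ∀ k → + ind (M d k) ≡ x k d
    x≗M k = sym (x-is-indicator k d)

  M-decomposes : Decomposes E M
  M-decomposes k with E k in isEdge
  ... | true = +-injective (begin
    + sumℕ (λ d → ind (M d k)) ≡⟨ sym (sumℤ-pos (λ d → ind (M d k))) ⟩
    sumℤ (λ d → + ind (M d k)) ≡⟨ sumℤ-cong (λ d → sym (x-is-indicator k d)) ⟩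
    sumℤ (λ d → x k d)         ≡⟨ sum-edges k isEdge ⟩
    ℤ.1ℤ                       ∎)
    where open ≡-Reasoning
  ... | false = sumℕ-zeros _ (λ d →
    +-injective (trans (sym (x-is-indicator k d)) (zero-off-edges k isEdge d)))

  dayMatchings : DayMatchings 2∣n E HA M
  dayMatchings = (λ d → M-crossing d , M-degree d) , M-decomposes

matchingsToPoint : ∀ {n r} (2∣n : 2 ∣ n) (E : Graph n) (HA : HAPTable n r)
  (M : Fin r → K n → Bool) → DayMatchings 2∣n E HA M →
  InP E HA (λ k d → + ind (M d k))
matchingsToPoint 2∣n E HA M (perfect , decomposes) =
  sum-edges , zero-off-edges , degree-one , bounds , zero-inside
  where
  sum-edges : ∀ k → E k ≡ true → sumℤ (λ d → + ind (M d k)) ≡ ℤ.1ℤ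
  sum-edges k isEdge =
    trans (sumℤ-pos (λ d → ind (M d k))) (cong +_ (trans (decomposes k) (cong ind isEdge)))

  zero-off-edges : ∀ k → E k ≡ false → ∀ d → + ind (M d k) ≡ ℤ.0ℤ
  zero-off-edges k notEdge =
    cong +_ ∘ sumℕ≡0⇒zeros _ (trans (decomposes k) (cong ind notEdge))

  degree-one : ∀ d a → sumℤ (λ b → at (λ k → + ind (M d k)) a b ℤ.0ℤ) ≡ ℤ.1ℤ
  degree-one d a = trans (sumℤ-cong (λ b → at-map +_ _ a b 0))
    (trans (sumℤ-pos (λ b → at (λ k → ind (M d k)) a b 0))
           (cong +_ (proj₂ (perfect d) a)))

  bounds : ∀ d k → E k ≡ true → (ℤ.0ℤ ℤ.≤ + ind (M d k)) × (+ ind (M d k) ℤ.≤ ℤ.1ℤ)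
  bounds d k _ = +≤+ z≤n , +≤+ (ind≤1 (M d k))

  zero-inside : ∀ d k → E k ≡ true →
    bothIn (lo k) (hi k) (H HA d) ⊎ bothIn (lo k) (hi k) (A HA d) → + ind (M d k) ≡ ℤ.0ℤ
  zero-inside d k _ withinSide with M d k in inM
  ... | false = refl
  ... | true = ⊥-elim (crossing-not-inside (disj HA d) (proj₁ (perfect d) k inM) withinSide)

toList : ∀ {m} {X : Set} → (Fin m → X) → List X
toList {zero} _ = []
toList {suc m} f = f zero ∷ toList (f ∘ suc)

vK-toList : ∀ {n m} (f : Fin m → PMElem n) k →
  vK (toList f) k ≡ sumℕ (λ d → ind (matching (f d) k))
vK-toList {m = zero} _ _ = refl
vK-toList {m = suc m} f k = cong (_+_ (ind (matching (f zero) k))) (vK-toList (f ∘ suc) k)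

vC-toList : ∀ {n m} (f : Fin m → PMElem n) c →
  vC (toList f) c ≡ sumℕ (λ d → ind (sameC (part (f d)) c))
vC-toList {m = zero} _ _ = refl
vC-toList {m = suc m} f c = cong (_+_ (ind (sameC (part (f zero)) c))) (vC-toList (f ∘ suc) c)

Counts : ∀ {n m} → List (PMElem n) → (Fin m → Cut n) → Set
Counts v D = ∀ c → vC v c ≡ sumℕ (λ d → ind (sameC (D d) c))

extract : ∀ {n} (c₀ : Cut n) (v : List (PMElem n)) → 1 ≤ vC v c₀ →
  Σ[ p ∈ PMElem n ] Σ[ v' ∈ List (PMElem n) ]
    (sameC (part p) c₀ ≡ true) ×
    (∀ c → vC v c ≡ ind (sameC (part p) c) + vC v' c) ×
    (∀ k → vK v k ≡ ind (matching p k) + vK v' k)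
extract c₀ (p ∷ ps) used with sameC (part p) c₀ in onC₀
... | true = p , ps , onC₀ , (λ _ → refl) , (λ _ → refl)
... | false with extract c₀ ps used
... | p' , ps' , p'onC₀ , splitC , splitK = p' , p ∷ ps' , p'onC₀ ,
  (λ c → trans (cong (_+_ (ind (sameC (part p) c))) (splitC c))
                (x∙yz≈y∙xz (ind (sameC (part p) c)) _ (vC ps' c))) ,
  (λ k → trans (cong (_+_ (ind (matching p k))) (splitK k))
                (x∙yz≈y∙xz (ind (matching p k)) _ (vK ps' k)))

peel : ∀ {n m} (D : Fin (suc m) → Cut n) (v : List (PMElem n)) → Counts v D →
  Σ[ p ∈ PMElem n ] Σ[ v' ∈ List (PMElem n) ]
    (sameC (part p) (D zero) ≡ true) × Counts v' (D ∘ suc) ×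
    (∀ k → vK v k ≡ ind (matching p k) + vK v' k)
peel D v counts with extract (D zero) v present
  where
  present : 1 ≤ vC v (D zero)
  present rewrite counts (D zero) | sameC-refl (D zero) = s≤s z≤n
... | p , v' , pOnD₀ , splitC , splitK = p , v' , pOnD₀ , counts' , splitK
  where
  counts' : Counts v' (D ∘ suc)
  counts' c = +-cancelˡ-≡ (ind (sameC (part p) c)) _ _ (begin
    ind (sameC (part p) c) + vC v' c                      ≡⟨ sym (splitC c) ⟩
    vC v c                                                ≡⟨ counts c ⟩
    ind (sameC (D zero) c) + sumℕ (λ d → ind (sameC (D (suc d)) c))
      ≡⟨ cong (λ b → ind b + _) (sym (sameC-trans {c = part p} {D zero} c pOnD₀)) ⟩
    ind (sameC (part p) c) + sumℕ (λ d → ind (sameC (D (suc d)) c)) ∎)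
    where open ≡-Reasoning

reindex : ∀ {n m} (D : Fin m → Cut n) (v : List (PMElem n)) → Counts v D →
  Σ[ f ∈ (Fin m → PMElem n) ] ((∀ d → sameC (part (f d)) (D d) ≡ true) ×
     (∀ k → vK v k ≡ sumℕ (λ d → ind (matching (f d) k))))
reindex {m = zero} D [] _ = (λ ()) , (λ ()) , (λ _ → refl)
reindex {m = zero} D (p ∷ ps) counts with counts (part p)
... | noneOnP rewrite sameC-refl (part p) with noneOnP
... | ()
reindex {m = suc m} D v counts with peel D v counts
... | p , v' , pOnD₀ , counts' , splitK with reindex (D ∘ suc) v' counts'
... | f , fOnD , sumK =
  (λ { zero → p ; (suc d) → f d }) ,
  (λ { zero → pOnD₀ ; (suc d) → fOnD d }) ,
  (λ k → trans (splitK k) (cong (_+_ (ind (matching p k))) (sumK k)))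

Represents : ∀ {n r} → Graph n → HAPTable n r → List (PMElem n) → Set
Represents E HA v = (∀ k → vK v k ≡ ind (E k)) × (∀ c → vC v c ≡ daysOf HA c)

matchingsToCombination : ∀ {n r} (2∣n : 2 ∣ n) (E : Graph n) (HA : HAPTable n r)
  (M : Fin r → K n → Bool) → DayMatchings 2∣n E HA M →
  Σ[ v ∈ List (PMElem n) ] Represents E HA v
matchingsToCombination 2∣n E HA M (perfect , decomposes) =
  toList f , (λ k → trans (vK-toList f k) (decomposes k)) , vC-toList f
  where
  f : Fin _ → PMElem _
  f d = pm (dayCut 2∣n HA d) (M d) (perfect d)

combinationToMatchings : ∀ {n r} (2∣n : 2 ∣ n) (E : Graph n) (HA : HAPTable n r)
  (v : List (PMElem n)) → Represents E HA v →
  Σ[ M ∈ (Fin r → K n → Bool) ] DayMatchings 2∣n E HA M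
combinationToMatchings 2∣n E HA v (onEdges , onCuts) with reindex (dayCut 2∣n HA) v onCuts
... | f , fOnDay , sumK = matching ∘ f , perfect , (λ k → trans (sym (sumK k)) (onEdges k))
  where
  perfect : ∀ d → PerfectMatching (dayCut 2∣n HA d) (matching (f d))
  perfect d = perfectMatching-resp {c = part (f d)} {dayCut 2∣n HA d} (fOnDay d) (isPM (f d))

lemma2 : (n r : ℕ) → 2 ∣ n → (E : Graph n) → Regular r E → (HA : HAPTable n r) →
    (Σ[ x ∈ (K n → Fin r → ℤ) ] InP E HA x) ⇔
    (Σ[ v ∈ List (PMElem n) ] ((∀ k → vK v k ≡ ind (E k)) × (∀ c → vC v c ≡ daysOf HA c)))
lemma2 n r 2∣n E _ HA = mk⇔ pointToCombination combinationToPoint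
  where
  pointToCombination : Σ[ x ∈ (K n → Fin r → ℤ) ] InP E HA x →
    Σ[ v ∈ List (PMElem n) ] Represents E HA v
  pointToCombination (x , x∈P) = matchingsToCombination 2∣n E HA M dayMatchings
    where open PointToMatchings 2∣n E HA x x∈P using (M; dayMatchings)

  combinationToPoint : Σ[ v ∈ List (PMElem n) ] Represents E HA v →
    Σ[ x ∈ (K n → Fin r → ℤ) ] InP E HA x
  combinationToPoint (v , represents) with combinationToMatchings 2∣n E HA v represents
  ... | M , dayMatchings = (λ k d → + ind (M d k)) , matchingsToPoint 2∣n E HA M dayMatchings
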